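{- Let $S_a,S_b,S_c,S_d$ be finite subsets of $\mathbb{Z}_{>0}^3$. Let $G$ be the set of positive integers $n$ for which there exist positive integers $a,b,c,d$ such that $(4abc-1)d=(a+b)n$ or $(4abc-1)d=an+b$, and such that at least one of the following holds: $(b,c,d)\in S_a$, $(a,c,d)\in S_b$, $(a,b,d)\in S_c$, $(a,b,c)\in S_d$. Then $G$ does not contain all primes of the form $4q+5$ with $q\in\mathbb{Z}_{\ge 0}$.
   Context: Informally: fixing three of the four parameters $a,b,c,d$ in one of the two equations to range over a finite set, and letting the remaining parameter range freely over the positive integers, one cannot cover all primes congruent to $1$ modulo $4$. -}

module Defs where

open import Data.Nat using (ℕ; _+_; _*_; _∸_; _>_)
open import Data.Product using (_×_; _,_; ∃-syntax)
open import Data.Sum using (_⊎_)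
open import Data.List using (List)
open import Data.List.Membership.Propositional using (_∈_)
open import Data.List.Relation.Unary.All using (All)
open import Relation.Binary.PropositionalEquality using (_≡_)

Triple : Set
Triple = ℕ × ℕ × ℕ

PosTriple : Triple → Set
PosTriple (x , y , z) = (x > 0) × (y > 0) × (z > 0)

-- A finite subset of ℤ_{>0}^3, represented by a list of its elements
-- all of which are positive triples.
FinPosSubset : List Triple → Set
FinPosSubset S = All PosTriple S

-- One of the two equations: (4abc-1)d = (a+b)n  or  (4abc-1)d = an + b.
-- (For a,b,c ≥ 1 we have 4abc ≥ 4, so truncated subtraction is exact.)
Eqn : ℕ → ℕ → ℕ → ℕ → ℕ → Set
Eqn n a b c d =
  ((4 * a * b * c ∸ 1) * d ≡ (a + b) * n) ⊎ ((4 * a * b * c ∸ 1) * d ≡ a * n + b)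

InSome : List Triple → List Triple → List Triple → List Triple →
         ℕ → ℕ → ℕ → ℕ → Set
InSome Sa Sb Sc Sd a b c d =
  ((b , c , d) ∈ Sa) ⊎ ((a , c , d) ∈ Sb) ⊎ ((a , b , d) ∈ Sc) ⊎ ((a , b , c) ∈ Sd)

InG : List Triple → List Triple → List Triple → List Triple → ℕ → Set
InG Sa Sb Sc Sd n =
  (n > 0) ×
  ∃[ a ] ∃[ b ] ∃[ c ] ∃[ d ]
    ((a > 0) × (b > 0) × (c > 0) × (d > 0) ×
     Eqn n a b c d × InSome Sa Sb Sc Sd a b c d)

{-# OPTIONS --safe #-}

-- Only primes p ≡ 1 (mod K!) are needed, and for them Dirichlet's theorem has an elementary
-- proof. Let x = 3L, N = L^L and A = x^N − 1. For each proper divisor t = L/u of L, A is the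
-- product of x^(t^L) − 1 and a geometric sum S_t. These first factors multiply to at most
-- x^E with 2^L·E ≤ L·N, which is less than A, so G = gcd(A, S_t ...) > 1. Let p be a prime
-- factor of G. If L did not divide e = gcd(N, p − 1), then e ∣ t^L for the proper divisor
-- t = gcd(e, L), so by Fermat x^(t^L) ≡ 1 and S_t ≡ u^L (mod p), whence p ∣ u ∣ x,
-- contradicting x^N ≡ 1. Thus L ∣ p − 1.
--
-- Take such a prime p for L = K!, with K at least 4 and at least every 4uvw over the listed
-- triples (u, v, w); then p = 4q + 5 and p ≡ 1 modulo every m ≤ K. If (b, c, d) ∈ S_a, the
-- equation gives 4abcd > a·p, so 4bcd > p > K. Otherwise the modulus μ = 4acd − 1, 4abd or
-- 4abc − 1 is at most K, and reducing the equation modulo μ (using p ≡ 1) leaves the residue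
-- a + d, a + b + d or a + b, which is positive and smaller than μ. The case S_b with the first
-- equation is symmetric to S_a.

module Submission where

open import Defs
open import Data.Nat
open import Data.Nat.Properties
open import Data.Nat.DivMod
open import Data.Nat.Divisibility
open import Data.Nat.GCD
open import Data.Nat.Combinatorics using (_C_; nC1≡n; nCn≡1; k>n⇒nCk≡0; nCk+nC[k+1]≡[n+1]C[k+1])
open import Data.Nat.Coprimality using (Coprime; coprime-divisor; coprime-/gcd)
open import Data.Nat.Primality using (Prime; euclidsLemma; prime⇒nonZero; ¬prime[0]; ¬prime[1])
open import Data.Nat.Primality.Factorisation using (factorise)
open import Data.Nat.ListAction using (sum; product)
open import Data.Nat.ListAction.Properties using (∈⇒∣product; product≢0)
open import Data.List using (List; []; _∷_; _++_; map; foldr; upTo; length)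
open import Data.List.Membership.Propositional using (_∈_)
open import Data.List.Relation.Unary.Any using (here; there)
open import Data.List.Relation.Unary.All using (All; []; _∷_; universal)
import Data.List.Relation.Unary.All as All
open import Data.List.Relation.Unary.All.Properties using (map⁺)
open import Data.List.Membership.Propositional.Properties using (∈-map⁺; ∈-upTo⁺; ∈-upTo⁻; ∈-++⁺ˡ; ∈-++⁺ʳ)
open import Data.List.Properties using (length-upTo)
open import Data.Product using (_×_; _,_; ∃-syntax)
open import Data.Nat.Tactic.RingSolver using (solve-∀)
open import Data.Sum using (_⊎_; inj₁; inj₂; [_,_]′)
open import Data.Empty using (⊥-elim)
open import Relation.Nullary using (¬_; yes; no)
open import Relation.Binary.PropositionalEquality

private
  variable
    a b c d k m n : ℕ

^-distribʳ-* : ∀ m n o → (m * n) ^ o ≡ m ^ o * n ^ o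
^-distribʳ-* m n zero    = refl
^-distribʳ-* m n (suc o) = begin
  m * n * (m * n) ^ o     ≡⟨ cong (m * n *_) (^-distribʳ-* m n o) ⟩
  m * n * (m ^ o * n ^ o) ≡⟨ interchange m n (m ^ o) (n ^ o) ⟩
  m * m ^ o * (n * n ^ o) ∎
  where
  open ≡-Reasoning
  interchange : ∀ w x y z → w * x * (y * z) ≡ w * y * (x * z)
  interchange = solve-∀

geometricSum : ℕ → ℕ → ℕ
geometricSum y zero    = 0
geometricSum y (suc k) = 1 + y * geometricSum y k

*-geometricSum : ∀ z k → z * geometricSum (suc z) k + 1 ≡ suc z ^ k
*-geometricSum z zero    = cong (_+ 1) (*-zeroʳ z)
*-geometricSum z (suc k) = trans (factor z (geometricSum (suc z) k)) (cong (suc z *_) (*-geometricSum z k))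
  where
  factor : ∀ z g → z * (1 + suc z * g) + 1 ≡ suc z * (z * g + 1)
  factor = solve-∀

[y∸1]*geometricSum≡yᵏ∸1 : ∀ y k → 1 ≤ y → (y ∸ 1) * geometricSum y k ≡ y ^ k ∸ 1
[y∸1]*geometricSum≡yᵏ∸1 (suc z) k _ = trans (sym (m+n∸n≡m (z * geometricSum (suc z) k) 1)) (cong (_∸ 1) (*-geometricSum z k))

-- Congruences modulo p

module Congruence (p : ℕ) .{{_ : NonZero p}} where

  infix 4 _≈_
  _≈_ : ℕ → ℕ → Set
  a ≈ b = a % p ≡ b % p

  +-cong : a ≈ b → c ≈ d → a + c ≈ b + d
  +-cong {a} {b} {c} {d} a≈b c≈d = begin
    (a + c) % p         ≡⟨ %-distribˡ-+ a c p ⟩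
    (a % p + c % p) % p ≡⟨ cong₂ (λ u v → (u + v) % p) a≈b c≈d ⟩
    (b % p + d % p) % p ≡⟨ %-distribˡ-+ b d p ⟨
    (b + d) % p         ∎
    where open ≡-Reasoning

  *-cong : a ≈ b → c ≈ d → a * c ≈ b * d
  *-cong {a} {b} {c} {d} a≈b c≈d = begin
    (a * c) % p             ≡⟨ %-distribˡ-* a c p ⟩
    (a % p * (c % p)) % p   ≡⟨ cong₂ (λ u v → (u * v) % p) a≈b c≈d ⟩
    (b % p * (d % p)) % p   ≡⟨ %-distribˡ-* b d p ⟨
    (b * d) % p             ∎
    where open ≡-Reasoning

  ^-congˡ : ∀ k → a ≈ b → a ^ k ≈ b ^ k
  ^-congˡ zero    a≈b = refl
  ^-congˡ (suc k) a≈b = *-cong a≈b (^-congˡ k a≈b)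

  0%p≡0 : 0 % p ≡ 0
  0%p≡0 = n∣m⇒m%n≡0 0 p (p ∣0)

  ∣⇒≈0 : p ∣ a → a ≈ 0
  ∣⇒≈0 {a} p∣a = trans (n∣m⇒m%n≡0 a p p∣a) (sym 0%p≡0)

  ≈0⇒∣ : a ≈ 0 → p ∣ a
  ≈0⇒∣ {a} a≈0 = m%n≡0⇒n∣m a p (trans a≈0 0%p≡0)

  ∣∸⇒≈ : b ≤ a → p ∣ a ∸ b → a ≈ b
  ∣∸⇒≈ {b} {a} b≤a p∣a∸b = begin
    a % p           ≡⟨ cong (_% p) (m∸n+n≡m b≤a) ⟨
    (a ∸ b + b) % p ≡⟨ %-remove-+ˡ b p∣a∸b ⟩
    b % p           ∎
    where open ≡-Reasoning

  ≈⇒∣∸ : a ≈ b → p ∣ a ∸ b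
  ≈⇒∣∸ {a} {b} a≈b = divides (a / p ∸ b / p) (begin
    a ∸ b                                     ≡⟨ cong₂ _∸_ (m≡m%n+[m/n]*n a p) (m≡m%n+[m/n]*n b p) ⟩
    (a % p + a / p * p) ∸ (b % p + b / p * p) ≡⟨ cong (λ r → (r + a / p * p) ∸ (b % p + b / p * p)) a≈b ⟩
    (b % p + a / p * p) ∸ (b % p + b / p * p) ≡⟨ [m+n]∸[m+o]≡n∸o (b % p) (a / p * p) (b / p * p) ⟩
    a / p * p ∸ b / p * p                     ≡⟨ *-distribʳ-∸ p (a / p) (b / p) ⟨
    (a / p ∸ b / p) * p                       ∎)
    where open ≡-Reasoning

  *-cancelˡ-≈ : Prime p → ¬ p ∣ c → c * a ≈ c * b → a ≈ b
  *-cancelˡ-≈ {c} {a} {b} p-prime p∤c ca≈cb =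
    [ (λ b≤a → cancel b≤a ca≈cb) , (λ a≤b → sym (cancel a≤b (sym ca≈cb))) ]′ (≤-total b a)
    where
    cancel : ∀ {a b} → b ≤ a → c * a ≈ c * b → a ≈ b
    cancel {a} {b} b≤a e with euclidsLemma c (a ∸ b) p-prime (subst (p ∣_) (sym (*-distribˡ-∸ c a b)) (≈⇒∣∸ e))
    ... | inj₁ p∣c   = ⊥-elim (p∤c p∣c)
    ... | inj₂ p∣a∸b = ∣∸⇒≈ b≤a p∣a∸b

  geometricSum≈ : ∀ {y} k → y ≈ 1 → geometricSum y k ≈ k
  geometricSum≈     zero    y≈1 = refl
  geometricSum≈ {y} (suc k) y≈1 = +-cong {1} refl (begin
    y * geometricSum y k % p ≡⟨ *-cong y≈1 (geometricSum≈ k y≈1) ⟩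
    1 * k % p                ≡⟨ cong (_% p) (*-identityˡ k) ⟩
    k % p                    ∎)
    where open ≡-Reasoning

  ^≈1-∣ : ∀ x → m ∣ n → x ^ m ≈ 1 → x ^ n ≈ 1
  ^≈1-∣ {m} x (divides-refl q) xᵐ≈1 = begin
    x ^ (q * m) % p ≡⟨ cong (λ e → x ^ e % p) (*-comm q m) ⟩
    x ^ (m * q) % p ≡⟨ cong (_% p) (^-*-assoc x m q) ⟨
    (x ^ m) ^ q % p ≡⟨ ^-congˡ q xᵐ≈1 ⟩
    1 ^ q % p       ≡⟨ cong (_% p) (^-zeroˡ q) ⟩
    1 % p           ∎
    where open ≡-Reasoning

  ^≈1-+⇒^≈1 : ∀ x → x ^ (m + n) ≈ 1 → x ^ n ≈ 1 → x ^ m ≈ 1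
  ^≈1-+⇒^≈1 {m} {n} x xᵐ⁺ⁿ≈1 xⁿ≈1 = begin
    x ^ m % p         ≡⟨ cong (_% p) (*-identityʳ (x ^ m)) ⟨
    x ^ m * 1 % p     ≡⟨ *-cong {x ^ m} refl (sym xⁿ≈1) ⟩
    x ^ m * x ^ n % p ≡⟨ cong (_% p) (^-distribˡ-+-* x m n) ⟨
    x ^ (m + n) % p   ≡⟨ xᵐ⁺ⁿ≈1 ⟩
    1 % p             ∎
    where open ≡-Reasoning

  ^≈1-gcd : ∀ x → x ^ m ≈ 1 → x ^ n ≈ 1 → x ^ gcd m n ≈ 1
  ^≈1-gcd {m} {n} x xᵐ≈1 xⁿ≈1 with Bézout.identity {m} {n} (gcd-GCD m n)
  ... | Bézout.Identity.+- u v eq =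
    ^≈1-+⇒^≈1 {gcd m n} {v * n} x (subst (λ e → x ^ e ≈ 1) (sym eq) (^≈1-∣ x (n∣m*n u) xᵐ≈1)) (^≈1-∣ x (n∣m*n v) xⁿ≈1)
  ... | Bézout.Identity.-+ u v eq =
    ^≈1-+⇒^≈1 {gcd m n} {u * m} x (subst (λ e → x ^ e ≈ 1) (sym eq) (^≈1-∣ x (n∣m*n v) xⁿ≈1)) (^≈1-∣ x (n∣m*n u) xᵐ≈1)

-- Fermat's little theorem

[k+1]*[n+1]C[k+1]≡[n+1]*nCk : ∀ n k → suc k * (suc n C suc k) ≡ suc n * (n C k)
[k+1]*[n+1]C[k+1]≡[n+1]*nCk zero    zero    = refl
[k+1]*[n+1]C[k+1]≡[n+1]*nCk zero    (suc k) = *-zeroʳ (suc (suc k))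
[k+1]*[n+1]C[k+1]≡[n+1]*nCk (suc n) zero    = trans (+-identityʳ _) (trans (nC1≡n (suc (suc n))) (sym (*-identityʳ (suc (suc n)))))
[k+1]*[n+1]C[k+1]≡[n+1]*nCk (suc n) (suc k) = begin
  suc (suc k) * (suc (suc n) C suc (suc k))
    ≡⟨ cong (suc (suc k) *_) (nCk+nC[k+1]≡[n+1]C[k+1] (suc n) (suc k)) ⟨
  suc (suc k) * (C₁ + C₂)
    ≡⟨ expand (suc k) C₁ C₂ ⟩
  suc k * C₁ + C₁ + suc (suc k) * C₂
    ≡⟨ cong₂ (λ u v → u + C₁ + v) ([k+1]*[n+1]C[k+1]≡[n+1]*nCk n k) ([k+1]*[n+1]C[k+1]≡[n+1]*nCk n (suc k)) ⟩
  suc n * (n C k) + C₁ + suc n * (n C suc k)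
    ≡⟨ collect (suc n) (n C k) (n C suc k) C₁ ⟩
  suc n * (n C k + n C suc k) + C₁
    ≡⟨ cong (λ c → suc n * c + C₁) (nCk+nC[k+1]≡[n+1]C[k+1] n k) ⟩
  suc n * C₁ + C₁
    ≡⟨ +-comm (suc n * C₁) C₁ ⟩
  suc (suc n) * C₁ ∎
  where
  open ≡-Reasoning
  C₁ = suc n C suc k
  C₂ = suc n C suc (suc k)
  expand : ∀ k c₁ c₂ → suc k * (c₁ + c₂) ≡ k * c₁ + c₁ + suc k * c₂
  expand = solve-∀
  collect : ∀ m x y c → m * x + c + m * y ≡ m * (x + y) + c
  collect = solve-∀

prime∣pCk : ∀ {p k} → Prime p → 0 < k → k < p → p ∣ p C k
prime∣pCk {suc n} {suc k} p-prime _ k<p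
  with euclidsLemma (suc k) (suc n C suc k) p-prime (divides (n C k) (trans ([k+1]*[n+1]C[k+1]≡[n+1]*nCk n k) (*-comm (suc n) (n C k))))
... | inj₁ p∣k   = ⊥-elim (<⇒≱ k<p (∣⇒≤ p∣k))
... | inj₂ p∣pCk = p∣pCk

binomialSum : ℕ → ℕ → ℕ → ℕ
binomialSum n a zero    = 0
binomialSum n a (suc m) = binomialSum n a m + (n C m) * a ^ m

binomialSum-pascal : ∀ n a m → binomialSum (suc n) a (suc m) ≡ binomialSum n a (suc m) + a * binomialSum n a m
binomialSum-pascal n a zero    = cong (binomialSum n a 1 +_) (sym (*-zeroʳ a))
binomialSum-pascal n a (suc m) = begin
  binomialSum (suc n) a (suc m) + (suc n C suc m) * a ^ suc m
    ≡⟨ cong₂ (λ s c → s + c * a ^ suc m) (binomialSum-pascal n a m) (sym (nCk+nC[k+1]≡[n+1]C[k+1] n m)) ⟩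
  binomialSum n a (suc m) + a * B + (n C m + n C suc m) * (a * a ^ m)
    ≡⟨ regroup B (n C m) (n C suc m) a (a ^ m) ⟩
  B + (n C m) * a ^ m + (n C suc m) * (a * a ^ m) + a * (B + (n C m) * a ^ m) ∎
  where
  open ≡-Reasoning
  B = binomialSum n a m
  regroup : ∀ B c₁ c₂ a x → B + c₁ * x + a * B + (c₁ + c₂) * (a * x) ≡ B + c₁ * x + c₂ * (a * x) + a * (B + c₁ * x)
  regroup = solve-∀

[1+a]^n≡binomialSum : ∀ n a → suc a ^ n ≡ binomialSum n a (suc n)
[1+a]^n≡binomialSum zero    a = refl
[1+a]^n≡binomialSum (suc n) a = begin
  suc a * suc a ^ n                   ≡⟨ cong (suc a *_) ([1+a]^n≡binomialSum n a) ⟩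
  suc a * X                           ≡⟨ cong (_+ a * X) (+-identityʳ X) ⟨
  X + 0 + a * X                       ≡⟨ cong (λ c → X + c * a ^ suc n + a * X) (k>n⇒nCk≡0 (n<1+n n)) ⟨
  X + (n C suc n) * a ^ suc n + a * X ≡⟨ binomialSum-pascal n a (suc n) ⟨
  binomialSum (suc n) a (suc (suc n)) ∎
  where
  open ≡-Reasoning
  X = binomialSum n a (suc n)

module Fermat {p : ℕ} (p-prime : Prime p) where

  private instance
    p≢0 : NonZero p
    p≢0 = prime⇒nonZero p-prime

  open Congruence p

  binomialSum≈1 : ∀ a m → 0 < m → m ≤ p → binomialSum p a m ≈ 1
  binomialSum≈1 a 1             _ _   = refl
  binomialSum≈1 a (suc (suc m)) _ m<p = begin
    (binomialSum p a (suc m) + (p C suc m) * a ^ suc m) % p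
      ≡⟨ %-remove-+ʳ (binomialSum p a (suc m)) (∣m⇒∣m*n (a ^ suc m) (prime∣pCk p-prime z<s m<p)) ⟩
    binomialSum p a (suc m) % p
      ≡⟨ binomialSum≈1 a (suc m) z<s (<⇒≤ m<p) ⟩
    1 % p ∎
    where open ≡-Reasoning

  frobenius : ∀ a → suc a ^ p ≈ suc (a ^ p)
  frobenius a = begin
    suc a ^ p % p                             ≡⟨ cong (_% p) ([1+a]^n≡binomialSum p a) ⟩
    (binomialSum p a p + (p C p) * a ^ p) % p ≡⟨ cong (λ c → (binomialSum p a p + c * a ^ p) % p) (nCn≡1 p) ⟩
    (binomialSum p a p + 1 * a ^ p) % p       ≡⟨ +-cong (binomialSum≈1 a p (>-nonZero⁻¹ p) ≤-refl) (cong (_% p) (*-identityˡ (a ^ p))) ⟩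
    suc (a ^ p) % p                           ∎
    where open ≡-Reasoning

  fermat : ∀ a → a ^ p ≈ a
  fermat zero    = cong (λ e → 0 ^ e % p) (sym (suc-pred p))
  fermat (suc a) = trans (frobenius a) (+-cong {1} refl (fermat a))

  fermat′ : ∀ a → ¬ p ∣ a → a ^ (p ∸ 1) ≈ 1
  fermat′ a p∤a = *-cancelˡ-≈ p-prime p∤a (begin
    a * a ^ (p ∸ 1) % p  ≡⟨ cong (λ e → a ^ e % p) (suc-pred p) ⟩
    a ^ p % p            ≡⟨ fermat a ⟩
    a % p                ≡⟨ cong (_% p) (*-identityʳ a) ⟨
    a * 1 % p            ∎)
    where open ≡-Reasoning

-- Primes congruent to 1 modulo L

coprime-divisor-^ : Coprime m n → m ∣ n ^ k * c → m ∣ c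
coprime-divisor-^ {m} {n} {zero}  {c} _     m∣1*c = subst (m ∣_) (*-identityˡ c) m∣1*c
coprime-divisor-^ {m} {n} {suc k} {c} coprm m∣nᵏ⁺¹c =
  coprime-divisor-^ {k = k} coprm (coprime-divisor coprm (subst (m ∣_) (*-assoc n (n ^ k) c) m∣nᵏ⁺¹c))

∣^⇒∣gcd^ : ∀ {e L} k .{{_ : NonZero L}} → e ∣ L ^ k → e ∣ gcd e L ^ k
∣^⇒∣gcd^ zero e∣1 = e∣1
∣^⇒∣gcd^ {e} {L} (suc k) e∣Lᵏ⁺¹ =
  subst₂ _∣_ (m/n*n≡m (gcd[m,n]∣m e L)) (*-comm (g ^ k) g) (*-monoˡ-∣ g e′∣gᵏ)
  where
  g = gcd e L
  instance
    g≢0 : NonZero g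
    g≢0 = ≢-nonZero (gcd[m,n]≢0 e L (inj₂ (≢-nonZero⁻¹ L)))
  e′ = e / g
  L′ = L / g
  rearrange : ∀ l g → (l * g) ^ suc k ≡ l ^ suc k * g ^ k * g
  rearrange l g = begin
    (l * g) ^ suc k          ≡⟨ ^-distribʳ-* l g (suc k) ⟩
    l ^ suc k * (g * g ^ k)  ≡⟨ shuffle (l ^ suc k) g (g ^ k) ⟩
    l ^ suc k * g ^ k * g    ∎
    where
    open ≡-Reasoning
    shuffle : ∀ x y z → x * (y * z) ≡ x * z * y
    shuffle = solve-∀
  e′g∣L′ᵏ⁺¹gᵏg : e′ * g ∣ L′ ^ suc k * g ^ k * g
  e′g∣L′ᵏ⁺¹gᵏg = subst₂ _∣_ (sym (m/n*n≡m (gcd[m,n]∣m e L)))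
    (trans (cong (_^ suc k) (sym (m/n*n≡m (gcd[m,n]∣n e L)))) (rearrange L′ g)) e∣Lᵏ⁺¹
  e′∣gᵏ : e′ ∣ g ^ k
  e′∣gᵏ = coprime-divisor-^ {k = suc k} (coprime-/gcd e L) (*-cancelʳ-∣ g e′g∣L′ᵏ⁺¹gᵏg)

prime∣^⇒∣ : ∀ {p} k → Prime p → p ∣ m ^ k → p ∣ m
prime∣^⇒∣ {m} {p} zero    p-prime p∣1 = ⊥-elim (¬prime[1] (subst Prime (∣1⇒≡1 p∣1) p-prime))
prime∣^⇒∣ {m} {p} (suc k) p-prime p∣mᵏ⁺¹ with euclidsLemma m (m ^ k) p-prime p∣mᵏ⁺¹
... | inj₁ p∣m  = p∣m
... | inj₂ p∣mᵏ = prime∣^⇒∣ k p-prime p∣mᵏ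

∃prime∣ : ∀ n .{{_ : NonZero n}} → n ≢ 1 → ∃[ p ] Prime p × p ∣ n
∃prime∣ n n≢1 with factorise n
... | record { factors = [] ; isFactorisation = n≡1 } = ⊥-elim (n≢1 n≡1)
... | record { factors = q ∷ qs ; isFactorisation = n≡∏ ; factorsPrime = q-prime ∷ _ } =
  q , q-prime , subst (q ∣_) (sym n≡∏) (∈⇒∣product (here {xs = qs} refl))

n<2^n : ∀ n → n < 2 ^ n
n<2^n zero    = z<s
n<2^n (suc n) = +-mono-≤ (m^n>0 2 n) (≤-trans (n<2^n n) (m≤m+n (2 ^ n) 0))

n≤n! : ∀ n → n ≤ n !
n≤n! zero    = z≤n
n≤n! (suc n) = m≤m*n (suc n) (n !) {{n !≢0}}

foldr-gcd∣ : ∀ a ns → foldr gcd a ns ∣ a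
foldr-gcd∣ a []       = ∣-refl
foldr-gcd∣ a (n ∷ ns) = ∣-trans (gcd[m,n]∣n n (foldr gcd a ns)) (foldr-gcd∣ a ns)

∈⇒foldr-gcd∣ : ∀ {a ns} → n ∈ ns → foldr gcd a ns ∣ n
∈⇒foldr-gcd∣ {a = a} {n ∷ ns} (here refl)   = gcd[m,n]∣m n (foldr gcd a ns)
∈⇒foldr-gcd∣ {a = a} {m ∷ ns} (there n∈ns) = ∣-trans (gcd[m,n]∣n m (foldr gcd a ns)) (∈⇒foldr-gcd∣ n∈ns)

∣product*foldr-gcd : ∀ {a} (f g : ℕ → ℕ) → (∀ t → a ≡ f t * g t) →
                     ∀ ts → a ∣ product (map f ts) * foldr gcd a (map g ts)
∣product*foldr-gcd {a} f g a≡fg [] = subst (a ∣_) (sym (*-identityˡ a)) ∣-refl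
∣product*foldr-gcd {a} f g a≡fg (t ∷ ts) =
  ∣-trans (∣product*foldr-gcd f g a≡fg ts) (subst (P * G ∣_) (regroup P (f t) (gcd (g t) G)) (*-monoʳ-∣ P G∣ft*gcd))
  where
  P = product (map f ts)
  G = foldr gcd a (map g ts)
  ft*gcd≡gcd : f t * gcd (g t) G ≡ gcd a (f t * G)
  ft*gcd≡gcd = trans (c*gcd[m,n]≡gcd[cm,cn] (f t) (g t) G) (cong (λ h → gcd h (f t * G)) (sym (a≡fg t)))
  G∣ft*gcd : G ∣ f t * gcd (g t) G
  G∣ft*gcd = subst (G ∣_) (sym ft*gcd≡gcd) (gcd-greatest (foldr-gcd∣ a (map g ts)) (n∣m*n (f t)))
  regroup : ∀ P b h → P * (b * h) ≡ b * P * h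
  regroup = solve-∀

product≤^sum : ∀ {x} (f e : ℕ → ℕ) → (∀ t → f t ≤ x ^ e t) → ∀ ts → product (map f ts) ≤ x ^ sum (map e ts)
product≤^sum     f e f≤xᵉ []       = ≤-refl
product≤^sum {x} f e f≤xᵉ (t ∷ ts) = begin
  f t * product (map f ts)        ≤⟨ *-mono-≤ (f≤xᵉ t) (product≤^sum f e f≤xᵉ ts) ⟩
  x ^ e t * x ^ sum (map e ts)    ≡⟨ ^-distribˡ-+-* x (e t) (sum (map e ts)) ⟨
  x ^ (e t + sum (map e ts))      ∎
  where open ≤-Reasoning

*-sum≤length* : ∀ {k c} (f : ℕ → ℕ) {ts} → All (λ t → k * f t ≤ c) ts → k * sum (map f ts) ≤ length ts * c
*-sum≤length* {k}     f []                          = ≤-reflexive (*-zeroʳ k)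
*-sum≤length* {k} {c} f {t ∷ ts} (kft≤c ∷ kfts≤c) = begin
  k * (f t + sum (map f ts))   ≡⟨ *-distribˡ-+ k (f t) (sum (map f ts)) ⟩
  k * f t + k * sum (map f ts) ≤⟨ +-mono-≤ kft≤c (*-sum≤length* {k} {c} f kfts≤c) ⟩
  c + length ts * c            ∎
  where open ≤-Reasoning

module PrimeCongruentToOne (L : ℕ) .{{_ : NonZero L}} where

  x N A : ℕ
  x = 3 * L
  N = L ^ L
  A = x ^ N ∸ 1

  y : ℕ → ℕ
  y t = x ^ (t ^ L)

  instance
    x≢0 : NonZero x
    x≢0 = m*n≢0 3 L
    N≢0 : NonZero N
    N≢0 = m^n≢0 L L

  1≤xᵏ : ∀ k → 1 ≤ x ^ k
  1≤xᵏ k = m^n>0 x k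

  -- For t ∣ L with L = u·t, x^N − 1 = (y − 1)(1 + y + ⋯ + y^(u^L − 1)) where y = x^(t^L);
  -- for t ∤ L the trivial splitting A = 1 · A is used.
  lowerFactor upperFactor lowerExponent : ℕ → ℕ
  lowerFactor t with t ∣? L
  ... | yes _ = y t ∸ 1
  ... | no  _ = 1
  upperFactor t with t ∣? L
  ... | yes (divides u _) = geometricSum (y t) (u ^ L)
  ... | no  _             = A
  lowerExponent t with t ∣? L
  ... | yes _ = t ^ L
  ... | no  _ = 0

  A≡lower*upper : ∀ t → A ≡ lowerFactor t * upperFactor t
  A≡lower*upper t with t ∣? L
  ... | no  _                = sym (*-identityˡ A)
  ... | yes (divides u L≡ut) = sym (begin
    (y t ∸ 1) * geometricSum (y t) (u ^ L) ≡⟨ [y∸1]*geometricSum≡yᵏ∸1 (y t) (u ^ L) (1≤xᵏ (t ^ L)) ⟩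
    y t ^ (u ^ L) ∸ 1                       ≡⟨ cong (_∸ 1) (^-*-assoc x (t ^ L) (u ^ L)) ⟩
    x ^ (t ^ L * u ^ L) ∸ 1                 ≡⟨ cong (λ e → x ^ e ∸ 1) (*-comm (t ^ L) (u ^ L)) ⟩
    x ^ (u ^ L * t ^ L) ∸ 1                 ≡⟨ cong (λ e → x ^ e ∸ 1) (^-distribʳ-* u t L) ⟨
    x ^ ((u * t) ^ L) ∸ 1                   ≡⟨ cong (λ l → x ^ (l ^ L) ∸ 1) L≡ut ⟨
    A                                       ∎)
    where open ≡-Reasoning

  lowerFactor≢0 : ∀ t → NonZero (lowerFactor t)
  lowerFactor≢0 t with t ∣? L
  ... | no  _                = _
  ... | yes (divides u L≡ut) = >-nonZero (m<n⇒0<n∸m (begin-strict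
    1           <⟨ s≤s (s≤s z≤n) ⟩
    3           ≤⟨ m≤m*n 3 L ⟩
    x           ≡⟨ *-identityʳ x ⟨
    x ^ 1       ≤⟨ ^-monoʳ-≤ x (m^n>0 t L) ⟩
    y t         ∎))
    where
    open ≤-Reasoning
    instance
      t≢0 : NonZero t
      t≢0 = ≢-nonZero (λ { refl → ≢-nonZero⁻¹ L (trans L≡ut (*-zeroʳ u)) })

  lowerFactor≤xᵉ : ∀ t → lowerFactor t ≤ x ^ lowerExponent t
  lowerFactor≤xᵉ t with t ∣? L
  ... | yes _ = m∸n≤m (y t) 1
  ... | no  _ = ≤-refl

  2ᴸ*lowerExponent≤N : ∀ t → t < L → 2 ^ L * lowerExponent t ≤ N
  2ᴸ*lowerExponent≤N t t<L with t ∣? L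
  ... | no  _                            = ≤-trans (≤-reflexive (*-zeroʳ (2 ^ L))) z≤n
  ... | yes (divides 0 L≡0)              = ⊥-elim (≢-nonZero⁻¹ L L≡0)
  ... | yes (divides 1 L≡t+0)            = ⊥-elim (<⇒≢ t<L (sym (trans L≡t+0 (+-identityʳ t))))
  ... | yes (divides (suc (suc u)) L≡ut) = begin
    2 ^ L * t ^ L   ≡⟨ ^-distribʳ-* 2 t L ⟨
    (2 * t) ^ L     ≤⟨ ^-monoˡ-≤ L (subst (2 * t ≤_) (sym L≡ut) (*-monoˡ-≤ t {2} {suc (suc u)} (s≤s (s≤s z≤n)))) ⟩
    N               ∎
    where open ≤-Reasoning

  E P G : ℕ
  E = sum (map lowerExponent (upTo L))
  P = product (map lowerFactor (upTo L))
  G = foldr gcd A (map upperFactor (upTo L))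

  E<N : E < N
  E<N = ≰⇒> λ N≤E → <⇒≱ (*-monoˡ-< N (n<2^n L)) (begin
    2 ^ L * N           ≤⟨ *-monoʳ-≤ (2 ^ L) N≤E ⟩
    2 ^ L * E           ≤⟨ *-sum≤length* {2 ^ L} lowerExponent (All.tabulate (λ t∈ → 2ᴸ*lowerExponent≤N _ (∈-upTo⁻ t∈))) ⟩
    length (upTo L) * N ≡⟨ cong (_* N) (length-upTo L) ⟩
    L * N               ∎)
    where open ≤-Reasoning

  P<A : P < A
  P<A = begin-strict
    P     ≤⟨ product≤^sum lowerFactor lowerExponent lowerFactor≤xᵉ (upTo L) ⟩
    x ^ E <⟨ m+n≤o⇒m≤o∸n (suc (x ^ E)) (begin
               suc (x ^ E) + 1 ≤⟨ X+2≤3X (1≤xᵏ E) ⟩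
               3 * x ^ E       ≤⟨ *-monoˡ-≤ (x ^ E) (m≤m*n 3 L) ⟩
               x ^ suc E       ≤⟨ ^-monoʳ-≤ x E<N ⟩
               x ^ N           ∎) ⟩
    A     ∎
    where
    open ≤-Reasoning
    X+2≤3X : ∀ {X} → 1 ≤ X → suc X + 1 ≤ 3 * X
    X+2≤3X {suc X} _ = ≤-trans (m≤m+n (suc (suc X) + 1) (2 * X)) (≤-reflexive (split X))
      where
      split : ∀ X → suc (suc X) + 1 + 2 * X ≡ 3 * suc X
      split = solve-∀

  instance
    G≢0 : NonZero G
    G≢0 = ≢-nonZero λ G≡0 → <⇒≢ (≤-<-trans z≤n P<A) (sym (0∣⇒≡0 (subst (_∣ A) G≡0 (foldr-gcd∣ A (map upperFactor (upTo L))))))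

  G≢1 : G ≢ 1
  G≢1 G≡1 = <⇒≱ P<A (∣⇒≤ {{P≢0}} (subst (A ∣_) (trans (cong (P *_) G≡1) (*-identityʳ P)) A∣P*G))
    where
    P≢0 : NonZero P
    P≢0 = product≢0 (map⁺ (universal lowerFactor≢0 (upTo L)))
    A∣P*G : A ∣ P * G
    A∣P*G = ∣product*foldr-gcd lowerFactor upperFactor A≡lower*upper (upTo L)

  module _ {p : ℕ} (p-prime : Prime p) (p∣G : p ∣ G) where

    private instance
      p≢0 : NonZero p
      p≢0 = prime⇒nonZero p-prime

    open Congruence p
    open Fermat p-prime

    p∣A : p ∣ A
    p∣A = ∣-trans p∣G (foldr-gcd∣ A (map upperFactor (upTo L)))

    xᴺ≈1 : x ^ N ≈ 1
    xᴺ≈1 = ∣∸⇒≈ (1≤xᵏ N) p∣A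

    p∤x : ¬ p ∣ x
    p∤x p∣x = ¬prime[1] (subst Prime (∣1⇒≡1 p∣1) p-prime)
      where
      p∣xᴺ : p ∣ x ^ N
      p∣xᴺ = subst (λ k → p ∣ x ^ k) (suc-pred N) (∣m⇒∣m*n (x ^ pred N) p∣x)
      p∣1 : p ∣ 1
      p∣1 = ∣m+n∣m⇒∣n (subst (p ∣_) (sym (m∸n+n≡m (1≤xᵏ N))) p∣xᴺ) p∣A

    upperFactor-∣ : ∀ t → t ∣ L → p ∣ upperFactor t → y t ≈ 1 → p ∣ x
    upperFactor-∣ t t∣L p∣S yₜ≈1 with t ∣? L
    ... | no  t∤L              = ⊥-elim (t∤L t∣L)
    ... | yes (divides u L≡ut) = ∣-trans p∣u (∣-trans (divides t (trans L≡ut (*-comm u t))) (n∣m*n 3))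
      where
      p∣u : p ∣ u
      p∣u = prime∣^⇒∣ L p-prime (≈0⇒∣ (trans (sym (geometricSum≈ (u ^ L) yₜ≈1)) (∣⇒≈0 p∣S)))

    e : ℕ
    e = gcd N (p ∸ 1)

    L∣p∸1 : L ∣ p ∸ 1
    L∣p∸1 with L ∣? e
    ... | yes L∣e = ∣-trans L∣e (gcd[m,n]∣n N (p ∸ 1))
    ... | no  L∤e = ⊥-elim (p∤x (upperFactor-∣ t t∣L p∣upperFactor yₜ≈1))
      where
      t = gcd e L
      t∣L : t ∣ L
      t∣L = gcd[m,n]∣n e L
      t<L : t < L
      t<L = ≤∧≢⇒< (∣⇒≤ t∣L) (λ t≡L → L∤e (subst (_∣ e) t≡L (gcd[m,n]∣m e L)))
      p∣upperFactor : p ∣ upperFactor t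
      p∣upperFactor = ∣-trans p∣G (∈⇒foldr-gcd∣ (∈-map⁺ upperFactor (∈-upTo⁺ t<L)))
      yₜ≈1 : y t ≈ 1
      yₜ≈1 = ^≈1-∣ x (∣^⇒∣gcd^ L (gcd[m,n]∣m N (p ∸ 1))) (^≈1-gcd {N} {p ∸ 1} x xᴺ≈1 (fermat′ x p∤x))

∃-prime-≡1-mod : ∀ L .{{_ : NonZero L}} → ∃[ p ] Prime p × L ∣ p ∸ 1
∃-prime-≡1-mod L =
  let p , p-prime , p∣G = ∃prime∣ G G≢1 in p , p-prime , L∣p∸1 p-prime p∣G
  where open PrimeCongruentToOne L

∃-prime>-≡1-mod-≤ : ∀ K → ∃[ p ] Prime p × K < p × (∀ {m} .{{_ : NonZero m}} → m ≤ K → m ∣ p ∸ 1)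
∃-prime>-≡1-mod-≤ K =
  let p , p-prime , K!∣p∸1 = ∃-prime-≡1-mod (K !) {{K !≢0}}
  in p , p-prime , K<p p-prime K!∣p∸1 , (λ m≤K → ∣-trans (∣K! m≤K) K!∣p∸1)
  where
  ∣K! : ∀ {m} .{{_ : NonZero m}} → m ≤ K → m ∣ K !
  ∣K! {suc m} m≤K = ∣-trans (m∣m*n (m !)) (m≤n⇒m!∣n! m≤K)
  K<p : ∀ {p} → Prime p → K ! ∣ p ∸ 1 → K < p
  K<p {0}           p-prime _       = ⊥-elim (¬prime[0] p-prime)
  K<p {1}           p-prime _       = ⊥-elim (¬prime[1] p-prime)
  K<p {suc (suc n)} _       K!∣1+n = s≤s (≤-trans (n≤n! K) (∣⇒≤ K!∣1+n))

4∣p∸1⇒≡4q+5 : ∀ {p} → 4 ∣ p ∸ 1 → 4 < p → ∃[ q ] 4 * q + 5 ≡ p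
4∣p∸1⇒≡4q+5 {suc .(0 * 4)}     (divides-refl zero)    4<p = ⊥-elim (<⇒≱ 4<p (s≤s z≤n))
4∣p∸1⇒≡4q+5 {suc .(suc q * 4)} (divides-refl (suc q)) _   = q , split q
  where
  split : ∀ q → 4 * q + 5 ≡ suc (suc q * 4)
  split = solve-∀

-- Primes outside G

[m∸1]*n+n≡m*n : ∀ m n .{{_ : NonZero m}} → (m ∸ 1) * n + n ≡ m * n
[m∸1]*n+n≡m*n (suc m) n = +-comm (m * n) n

+<4* : ∀ m n o .{{_ : NonZero m}} .{{_ : NonZero n}} .{{_ : NonZero o}} → m + n + o < 4 * m * n * o
+<4* (suc m) (suc n) (suc o) = ≤-trans (m≤m+n _ _) (≤-reflexive (sym (split m n o)))
  where
  split : ∀ m n o → 4 * suc m * suc n * suc o ≡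
          suc (suc m + suc n + suc o) + (3 * m + 3 * n + 3 * o + 4 * m * n + 4 * m * o + 4 * n * o + 4 * m * n * o)
  split = solve-∀

+<4*∸1 : ∀ m n o .{{_ : NonZero m}} .{{_ : NonZero n}} .{{_ : NonZero o}} → m + n < 4 * m * n * o ∸ 1
+<4*∸1 m n o = m+n≤o⇒m≤o∸n (suc (m + n)) (≤-trans (s≤s (+-monoʳ-≤ (m + n) (>-nonZero⁻¹ o))) (+<4* m n o))

*≡*+⇒< : ∀ m {n o} r .{{_ : NonZero r}} → m * n ≡ m * o + r → o < n
*≡*+⇒< m {n} {o} r eq = *-cancelˡ-< m o n (subst (m * o <_) (sym eq) (m<m+n (m * o) (>-nonZero⁻¹ r)))

∣[a*p+b]⇒∣[a+b] : ∀ a b {m p} .{{_ : NonZero p}} → m ∣ p ∸ 1 → m ∣ a * p + b → m ∣ a + b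
∣[a*p+b]⇒∣[a+b] a b {m} {suc n} m∣n m∣ap+b = ∣m+n∣m⇒∣n (subst (m ∣_) (split a b n) m∣ap+b) (∣n⇒∣m*n a m∣n)
  where
  split : ∀ a b n → a * suc n + b ≡ a * n + (a + b)
  split = solve-∀

-- Eqn with the truncated subtraction cleared (exact once 4abc ≥ 1).
Eqn′ : ℕ → ℕ → ℕ → ℕ → ℕ → Set
Eqn′ p a b c d = 4 * a * b * c * d ≡ (a + b) * p + d ⊎ 4 * a * b * c * d ≡ a * p + b + d

Eqn⇒Eqn′ : ∀ {p a b c d} .{{_ : NonZero a}} .{{_ : NonZero b}} .{{_ : NonZero c}} → Eqn p a b c d → Eqn′ p a b c d
Eqn⇒Eqn′ {p} {a@(suc _)} {b@(suc _)} {c@(suc _)} {d} (inj₁ eq) =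
  inj₁ (trans (sym ([m∸1]*n+n≡m*n (4 * a * b * c) d)) (cong (_+ d) eq))
Eqn⇒Eqn′ {p} {a@(suc _)} {b@(suc _)} {c@(suc _)} {d} (inj₂ eq) =
  inj₂ (trans (sym ([m∸1]*n+n≡m*n (4 * a * b * c) d)) (cong (_+ d) eq))

weight : Triple → ℕ
weight (u , v , w) = 4 * u * v * w

bound : List Triple → ℕ
bound S = sum (map weight S)

∈⇒weight≤bound : ∀ {t S} → t ∈ S → weight t ≤ bound S
∈⇒weight≤bound {S = t ∷ S} (here refl)  = m≤m+n (weight t) (bound S)
∈⇒weight≤bound {S = u ∷ S} (there t∈S) = ≤-trans (∈⇒weight≤bound t∈S) (m≤n+m (bound S) (weight u))

module _ {K p : ℕ} .{{_ : NonZero p}} (K<p : K < p) (≤K⇒∣p∸1 : ∀ {m} .{{_ : NonZero m}} → m ≤ K → m ∣ p ∸ 1) where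

  ¬Eqn-Sa : ∀ {a b c d} .{{_ : NonZero a}} .{{_ : NonZero b}} .{{_ : NonZero c}} .{{_ : NonZero d}} →
            4 * b * c * d ≤ K → ¬ Eqn p a b c d
  ¬Eqn-Sa {a@(suc _)} {b@(suc _)} {c@(suc _)} {d@(suc _)} 4bcd≤K eqn =
    <-asym K<p (<-≤-trans ([_,_]′ p<4bcd₁ p<4bcd₂ (Eqn⇒Eqn′ eqn)) 4bcd≤K)
    where
    regroup : ∀ a b c d → 4 * a * b * c * d ≡ a * (4 * b * c * d)
    regroup = solve-∀
    p<4bcd₁ : 4 * a * b * c * d ≡ (a + b) * p + d → p < 4 * b * c * d
    p<4bcd₁ eq = *≡*+⇒< a (d + b * p) (trans (sym (regroup a b c d)) (trans eq (shuffle a b d p)))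
      where
      shuffle : ∀ a b d p → (a + b) * p + d ≡ a * p + (d + b * p)
      shuffle = solve-∀
    p<4bcd₂ : 4 * a * b * c * d ≡ a * p + b + d → p < 4 * b * c * d
    p<4bcd₂ eq = *≡*+⇒< a (d + b) (trans (sym (regroup a b c d)) (trans eq (shuffle a b d p)))
      where
      shuffle : ∀ a b d p → a * p + b + d ≡ a * p + (d + b)
      shuffle = solve-∀

  ¬Eqn-Sb : ∀ {a b c d} .{{_ : NonZero a}} .{{_ : NonZero b}} .{{_ : NonZero c}} .{{_ : NonZero d}} →
            4 * a * c * d ≤ K → ¬ Eqn p a b c d
  ¬Eqn-Sb {a@(suc _)} {b@(suc _)} {c@(suc _)} {d@(suc _)} 4acd≤K eqn = [_,_]′ eqn₁ eqn₂ (Eqn⇒Eqn′ eqn)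
    where
    regroup : ∀ a b c d → 4 * a * b * c * d ≡ b * (4 * a * c * d)
    regroup = solve-∀
    eqn₁ : ¬ 4 * a * b * c * d ≡ (a + b) * p + d
    eqn₁ eq = <-asym K<p (<-≤-trans (*≡*+⇒< b (d + a * p) (trans (sym (regroup a b c d)) (trans eq (shuffle a b d p)))) 4acd≤K)
      where
      shuffle : ∀ a b d p → (a + b) * p + d ≡ b * p + (d + a * p)
      shuffle = solve-∀
    μ = 4 * a * c * d ∸ 1
    a+d<μ : a + d < μ
    a+d<μ = subst (λ k → a + d < k ∸ 1) (swap a c d) (+<4*∸1 a d c)
      where
      swap : ∀ a c d → 4 * a * d * c ≡ 4 * a * c * d
      swap = solve-∀
    eqn₂ : ¬ 4 * a * b * c * d ≡ a * p + b + d
    eqn₂ eq = >⇒∤ a+d<μ (∣[a*p+b]⇒∣[a+b] a d (≤K⇒∣p∸1 {{>-nonZero (≤-<-trans z≤n a+d<μ)}} (≤-trans (m∸n≤m _ 1) 4acd≤K))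
                (subst (μ ∣_) μb≡ap+d (m∣m*n b)))
      where
      μb≡ap+d : μ * b ≡ a * p + d
      μb≡ap+d = +-cancelʳ-≡ b (μ * b) (a * p + d) (begin
        μ * b + b              ≡⟨ [m∸1]*n+n≡m*n (4 * a * c * d) b ⟩
        4 * a * c * d * b      ≡⟨ trans (*-comm _ b) (sym (regroup a b c d)) ⟩
        4 * a * b * c * d      ≡⟨ eq ⟩
        a * p + b + d          ≡⟨ shuffle (a * p) b d ⟩
        a * p + d + b          ∎)
        where
        open ≡-Reasoning
        shuffle : ∀ x b d → x + b + d ≡ x + d + b
        shuffle = solve-∀

  ¬Eqn-Sc : ∀ {a b c d} .{{_ : NonZero a}} .{{_ : NonZero b}} .{{_ : NonZero c}} .{{_ : NonZero d}} →
            4 * a * b * d ≤ K → ¬ Eqn p a b c d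
  ¬Eqn-Sc {a@(suc _)} {b@(suc _)} {c@(suc _)} {d@(suc _)} 4abd≤K eqn =
    >⇒∤ (+<4* a b d) ([_,_]′ eqn₁ eqn₂ (Eqn⇒Eqn′ eqn))
    where
    M∣p∸1 : 4 * a * b * d ∣ p ∸ 1
    M∣p∸1 = ≤K⇒∣p∸1 4abd≤K
    M∣4abcd : 4 * a * b * d ∣ 4 * a * b * c * d
    M∣4abcd = divides c (regroup a b c d)
      where
      regroup : ∀ a b c d → 4 * a * b * c * d ≡ c * (4 * a * b * d)
      regroup = solve-∀
    eqn₁ : 4 * a * b * c * d ≡ (a + b) * p + d → 4 * a * b * d ∣ a + b + d
    eqn₁ eq = ∣[a*p+b]⇒∣[a+b] (a + b) d M∣p∸1 (subst (4 * a * b * d ∣_) eq M∣4abcd)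
    eqn₂ : 4 * a * b * c * d ≡ a * p + b + d → 4 * a * b * d ∣ a + b + d
    eqn₂ eq = subst (4 * a * b * d ∣_) (sym (+-assoc a b d))
      (∣[a*p+b]⇒∣[a+b] a (b + d) M∣p∸1 (subst (4 * a * b * d ∣_) (trans eq (+-assoc (a * p) b d)) M∣4abcd))

  ¬Eqn-Sd : ∀ {a b c d} .{{_ : NonZero a}} .{{_ : NonZero b}} .{{_ : NonZero c}} .{{_ : NonZero d}} →
            4 * a * b * c ≤ K → ¬ Eqn p a b c d
  ¬Eqn-Sd {a@(suc _)} {b@(suc _)} {c@(suc _)} {d@(suc _)} 4abc≤K eqn =
    >⇒∤ a+b<μ ([_,_]′ eqn₁ eqn₂ eqn)
    where
    μ = 4 * a * b * c ∸ 1
    a+b<μ : a + b < μ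
    a+b<μ = +<4*∸1 a b c
    μ∣p∸1 : μ ∣ p ∸ 1
    μ∣p∸1 = ≤K⇒∣p∸1 {{>-nonZero (≤-<-trans z≤n a+b<μ)}} (≤-trans (m∸n≤m _ 1) 4abc≤K)
    eqn₁ : μ * d ≡ (a + b) * p → μ ∣ a + b
    eqn₁ eq = subst (μ ∣_) (+-identityʳ (a + b))
      (∣[a*p+b]⇒∣[a+b] (a + b) 0 μ∣p∸1 (subst (μ ∣_) (trans eq (sym (+-identityʳ _))) (m∣m*n d)))
    eqn₂ : μ * d ≡ a * p + b → μ ∣ a + b
    eqn₂ eq = ∣[a*p+b]⇒∣[a+b] a b μ∣p∸1 (subst (μ ∣_) eq (m∣m*n d))

  ¬InG : ∀ {Sa Sb Sc Sd} → bound (Sa ++ Sb ++ Sc ++ Sd) ≤ K → ¬ InG Sa Sb Sc Sd p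
  ¬InG {Sa} {Sb} {Sc} {Sd} S≤K (_ , suc a , suc b , suc c , suc d , _ , _ , _ , _ , eqn , t∈S) = excluded t∈S
    where
    weight≤K : ∀ {t} → t ∈ Sa ++ Sb ++ Sc ++ Sd → weight t ≤ K
    weight≤K t∈S = ≤-trans (∈⇒weight≤bound t∈S) S≤K
    excluded : ¬ InSome Sa Sb Sc Sd (suc a) (suc b) (suc c) (suc d)
    excluded (inj₁ t∈Sa)               = ¬Eqn-Sa {suc a} {suc b} {suc c} {suc d} (weight≤K (∈-++⁺ˡ t∈Sa)) eqn
    excluded (inj₂ (inj₁ t∈Sb))        = ¬Eqn-Sb {suc a} {suc b} {suc c} {suc d} (weight≤K (∈-++⁺ʳ Sa (∈-++⁺ˡ t∈Sb))) eqn
    excluded (inj₂ (inj₂ (inj₁ t∈Sc))) = ¬Eqn-Sc {suc a} {suc b} {suc c} {suc d} (weight≤K (∈-++⁺ʳ Sa (∈-++⁺ʳ Sb (∈-++⁺ˡ t∈Sc)))) eqn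
    excluded (inj₂ (inj₂ (inj₂ t∈Sd))) = ¬Eqn-Sd {suc a} {suc b} {suc c} {suc d} (weight≤K (∈-++⁺ʳ Sa (∈-++⁺ʳ Sb (∈-++⁺ʳ Sc t∈Sd)))) eqn

lemma2p3 : (Sa Sb Sc Sd : List Triple) →
    FinPosSubset Sa → FinPosSubset Sb → FinPosSubset Sc → FinPosSubset Sd →
    ¬ ((q : ℕ) → Prime (4 * q + 5) → InG Sa Sb Sc Sd (4 * q + 5))
lemma2p3 Sa Sb Sc Sd _ _ _ _ all-in-G =
  let p , p-prime , K<p , ≤K⇒∣p∸1 = ∃-prime>-≡1-mod-≤ K
      q , 4q+5≡p = 4∣p∸1⇒≡4q+5 (≤K⇒∣p∸1 (m≤n+m 4 S)) (≤-<-trans (m≤n+m 4 S) K<p)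
  in ¬InG {{prime⇒nonZero p-prime}} K<p ≤K⇒∣p∸1 (m≤m+n S 4)
       (subst (InG Sa Sb Sc Sd) 4q+5≡p (all-in-G q (subst Prime (sym 4q+5≡p) p-prime)))
  where
  S = bound (Sa ++ Sb ++ Sc ++ Sd)
  K = S + 4
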